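{- For every $n\ge 1$: (1) for every $m\ge 2$, $\mathrm{Rank}(\mathrm{TRIBES}_{n,m})=\mathrm{Rank}(\mathrm{TRIBES}^d_{n,m})=n$; (2) for every $m\ge 1$, $\mathrm{Rank}(\mathrm{AND}_n\circ\mathrm{PARITY}_m)=n(m-1)+1$.
   Context: $\mathrm{TRIBES}_{n,m}=\mathrm{OR}_n\circ\mathrm{AND}_m$, i.e. $\bigvee_{i\in[n]}\bigwedge_{j\in[m]}x_{i,j}$; $\mathrm{TRIBES}^d_{n,m}=\mathrm{AND}_n\circ\mathrm{OR}_m=\bigwedge_{i\in[n]}\bigvee_{j\in[m]}x_{i,j}$; $\mathrm{AND}_n\circ\mathrm{PARITY}_m=\bigwedge_{i\in[n]}\bigoplus_{j\in[m]}x_{i,j}$. A decision tree queries single variables at internal nodes and has $0/1$-labelled leaves. The rank of a rooted binary tree: leaves have rank $0$; an internal node with children of ranks $a,b$ has rank $a+1$ if $a=b$, else $\max\{a,b\}$. $\mathrm{Rank}(f)$ is the minimum rank of a decision tree computing $f$. -}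

module Defs where

open import Data.Nat using (ℕ; zero; suc; _≤_; _⊔_)
open import Data.Bool using (Bool; true; false; _∧_; _∨_; _xor_; if_then_else_)
open import Data.Fin using (Fin; zero; suc)
open import Data.Product using (Σ; _×_; _,_)
open import Relation.Binary.PropositionalEquality using (_≡_)

-- Decision trees over a variable set V: internal nodes query a single
-- variable; the left subtree is taken when the variable is 0 (false),
-- the right subtree when it is 1 (true).
data DTree (V : Set) : Set where
  leaf  : Bool → DTree V
  query : V → DTree V → DTree V → DTree V

eval : {V : Set} → DTree V → (V → Bool) → Bool
eval (leaf b)      x = b
eval (query v l r) x = if x v then eval r x else eval l x

-- rank of a rooted binary tree: leaves 0; node with children of rank
-- a, b has rank a+1 if a = b, else max a b.
rankCombine : ℕ → ℕ → ℕ
rankCombine zero    zero    = 1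
rankCombine zero    (suc b) = suc b
rankCombine (suc a) zero    = suc a
rankCombine (suc a) (suc b) = suc (rankCombine a b)

rank : {V : Set} → DTree V → ℕ
rank (leaf _)      = 0
rank (query _ l r) = rankCombine (rank l) (rank r)

Computes : {V : Set} → DTree V → ((V → Bool) → Bool) → Set
Computes T f = ∀ x → eval T x ≡ f x

RankIs : {V : Set} → ((V → Bool) → Bool) → ℕ → Set
RankIs {V} f r =
  Σ (DTree V) (λ T → Computes T f × rank T ≡ r)
  × (∀ (T : DTree V) → Computes T f → r ≤ rank T)

Var : ℕ → ℕ → Set
Var n m = Fin n × Fin m

ANDℕ : (k : ℕ) → (Fin k → Bool) → Bool
ANDℕ zero    y = true
ANDℕ (suc k) y = y zero ∧ ANDℕ k (λ i → y (suc i))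

ORℕ : (k : ℕ) → (Fin k → Bool) → Bool
ORℕ zero    y = false
ORℕ (suc k) y = y zero ∨ ORℕ k (λ i → y (suc i))

PARITYℕ : (k : ℕ) → (Fin k → Bool) → Bool
PARITYℕ zero    y = false
PARITYℕ (suc k) y = y zero xor PARITYℕ k (λ i → y (suc i))

TRIBES : (n m : ℕ) → (Var n m → Bool) → Bool
TRIBES n m x = ORℕ n (λ i → ANDℕ m (λ j → x (i , j)))

TRIBESd : (n m : ℕ) → (Var n m → Bool) → Bool
TRIBESd n m x = ANDℕ n (λ i → ORℕ m (λ j → x (i , j)))

ANDPARITY : (n m : ℕ) → (Var n m → Bool) → Bool
ANDPARITY n m x = ANDℕ n (λ i → PARITYℕ m (λ j → x (i , j)))

-- Upper bounds: the tree for AND_n ∘ g runs a decision tree for g on each row in turn,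
-- continuing at its 1-leaves with the next row. An OR row raises the rank by one; a PARITY
-- row on m variables costs m on its own and m − 1 on top of a nonempty continuation.
--
-- Lower bounds are Prover–Delayer arguments. The Delayer keeps a restriction of the
-- function and a potential, and answers each query either by fixing the variable without
-- lowering the potential or by letting the Prover choose, losing at most one. A tree of
-- rank r has a child of rank < r and both children of rank ≤ r, and a restriction of
-- positive potential is nonconstant, so the potential never exceeds the rank.
-- For AND_n ∘ OR_m (m ≥ 2) the potential is the number of untouched clauses: the first
-- query in a clause is left to the Prover (after a 0 another literal remains), later ones
-- are answered 1. For AND_n ∘ PARITY_m it is 1 + Σᵢ (free variables of row i − 1): a row
-- with two free variables is left to the Prover, the last free variable of a row is set to
-- make the row's parity 1 while some other row keeps a free variable, and otherwise the
-- potential is already 1. TRIBES is the dual of TRIBES^d, and duality preserves rank.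

module Submission where

open import Data.Bool using (Bool; true; false; not; _∧_; _∨_; _xor_; if_then_else_)
open import Data.Bool.Properties using (not-involutive; not-distribˡ-xor; not-distribʳ-xor; xor-identityʳ; ¬-not)
open import Data.Bool.Instances
open import Data.Empty using (⊥-elim)
open import Data.Fin using (Fin; zero; suc; punchIn)
open import Data.Fin.Properties using (punchInᵢ≢i; any?) renaming (suc-injective to Fin-suc-injective)
open import Data.Fin.Instances
open import Data.Maybe using (Maybe; just; nothing; fromMaybe; maybe′)
open import Data.Nat using (ℕ; zero; suc; _≤_; _<_; _+_; _*_; _∸_; _⊔_; z≤n; s≤s; _≤?_)
open import Data.Nat.Properties
  using (≤-refl; ≤-trans; ≤-reflexive; ≤-antisym; ≤-pred; <⇒≤; ≰⇒>; n<1⇒n≡0; m≤n⇒m≤1+n; m≤n+m;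
         m≤m⊔n; m≤n⊔m; ⊔-lub; ⊔-mono-≤; ⊔-identityʳ; +-assoc; +-comm; +-identityʳ; +-monoʳ-≤;
         +-cancelʳ-≤; *-identityʳ; *-zeroʳ; m≤n+m∸n; m≤n⇒m∸n≡0; +-0-monoid; module ≤-Reasoning)
open import Data.Product using (Σ; ∃; ∃₂; _×_; _,_; proj₁; proj₂; uncurry)
open import Data.Product.Instances
open import Data.Sum using (_⊎_; inj₁; inj₂; [_,_]′)
open import Data.Vec.Functional using (Vector; updateAt)
open import Data.Vec.Functional.Properties using (updateAt-updates; updateAt-minimal; updateAt-id-local)
open import Algebra.Properties.Monoid.Sum +-0-monoid using (sum; sum-cong-≗)
open import Data.Nat.Tactic.RingSolver using (solve-∀)
open import Function using (_∘_; const)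
open import Relation.Binary.Structures using (IsDecEquivalence)
open import Relation.Binary.TypeClasses using (_≟_)
open import Relation.Nullary using (yes; no; does; ¬?; _×-dec_)
open import Relation.Nullary.Decidable using (toSum)
open import Relation.Binary.PropositionalEquality

open import Defs

ANDℕ-cong : ∀ k {y z : Fin k → Bool} → y ≗ z → ANDℕ k y ≡ ANDℕ k z
ANDℕ-cong zero    y≗z = refl
ANDℕ-cong (suc k) y≗z = cong₂ _∧_ (y≗z zero) (ANDℕ-cong k (y≗z ∘ suc))

ORℕ-cong : ∀ k {y z : Fin k → Bool} → y ≗ z → ORℕ k y ≡ ORℕ k z
ORℕ-cong zero    y≗z = refl
ORℕ-cong (suc k) y≗z = cong₂ _∨_ (y≗z zero) (ORℕ-cong k (y≗z ∘ suc))

PARITYℕ-cong : ∀ k {y z : Fin k → Bool} → y ≗ z → PARITYℕ k y ≡ PARITYℕ k z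
PARITYℕ-cong zero    y≗z = refl
PARITYℕ-cong (suc k) y≗z = cong₂ _xor_ (y≗z zero) (PARITYℕ-cong k (y≗z ∘ suc))

ANDℕ-true : ∀ k {y : Fin k → Bool} → (∀ i → y i ≡ true) → ANDℕ k y ≡ true
ANDℕ-true zero    all = refl
ANDℕ-true (suc k) all rewrite all zero = ANDℕ-true k (all ∘ suc)

ANDℕ-false : ∀ k {y : Fin k → Bool} i → y i ≡ false → ANDℕ k y ≡ false
ANDℕ-false (suc k)         zero    yi≡false rewrite yi≡false = refl
ANDℕ-false (suc k) {y = y} (suc i) yi≡false with y zero
... | true  = ANDℕ-false k i yi≡false
... | false = refl

ORℕ-true : ∀ k {y : Fin k → Bool} i → y i ≡ true → ORℕ k y ≡ true
ORℕ-true (suc k)         zero    yi≡true rewrite yi≡true = refl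
ORℕ-true (suc k) {y = y} (suc i) yi≡true with y zero
... | true  = refl
... | false = ORℕ-true k i yi≡true

ORℕ-false : ∀ k → ORℕ k (const false) ≡ false
ORℕ-false zero    = refl
ORℕ-false (suc k) = ORℕ-false k

ORℕ-deMorgan : ∀ k (y : Fin k → Bool) → ORℕ k (not ∘ y) ≡ not (ANDℕ k y)
ORℕ-deMorgan zero    y = refl
ORℕ-deMorgan (suc k) y with y zero
... | true  = ORℕ-deMorgan k (y ∘ suc)
... | false = refl

ANDℕ-deMorgan : ∀ k (y : Fin k → Bool) → ANDℕ k (not ∘ y) ≡ not (ORℕ k y)
ANDℕ-deMorgan zero    y = refl
ANDℕ-deMorgan (suc k) y with y zero
... | true  = refl
... | false = ANDℕ-deMorgan k (y ∘ suc)

PARITYℕ-flip : ∀ k {y z : Fin k → Bool} j → (∀ l → l ≢ j → z l ≡ y l) → z j ≡ not (y j) →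
               PARITYℕ k z ≡ not (PARITYℕ k y)
PARITYℕ-flip (suc k) {y} zero    same flip
  rewrite flip | PARITYℕ-cong k (λ l → same (suc l) λ ()) = sym (not-distribˡ-xor (y zero) _)
PARITYℕ-flip (suc k) {y} (suc j) same flip
  rewrite same zero (λ ()) | PARITYℕ-flip k j (λ l l≢j → same (suc l) (l≢j ∘ Fin-suc-injective)) flip
  = sym (not-distribʳ-xor (y zero) _)

module _ {V A : Set} {{_ : IsDecEquivalence {A = V} _≡_}} where

  infixl 9 _[_≔_]
  _[_≔_] : (V → A) → V → A → V → A
  (x [ v ≔ a ]) w = if does (w ≟ v) then a else x w

  update-same : ∀ (x : V → A) v a → (x [ v ≔ a ]) v ≡ a
  update-same x v a with v ≟ v
  ... | yes _   = refl
  ... | no v≢v = ⊥-elim (v≢v refl)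

  update-other : ∀ (x : V → A) {v w} a → w ≢ v → (x [ v ≔ a ]) w ≡ x w
  update-other x {v} {w} a w≢v with w ≟ v
  ... | yes w≡v = ⊥-elim (w≢v w≡v)
  ... | no _    = refl

  update-cong : ∀ {x y : V → A} v a → x ≗ y → x [ v ≔ a ] ≗ y [ v ≔ a ]
  update-cong v a x≗y w = cong (if does (w ≟ v) then a else_) (x≗y w)

  update-update : ∀ (x : V → A) v a c → x [ v ≔ a ] [ v ≔ c ] ≗ x [ v ≔ c ]
  update-update x v a c w with w ≟ v
  ... | yes _ = refl
  ... | no _  = refl

  update-self : ∀ (x : V → A) v → x [ v ≔ x v ] ≗ x
  update-self x v w with w ≟ v
  ... | yes refl = refl
  ... | no _     = refl

rankCombine-comm : ∀ a b → rankCombine a b ≡ rankCombine b a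
rankCombine-comm zero    zero    = refl
rankCombine-comm zero    (suc b) = refl
rankCombine-comm (suc a) zero    = refl
rankCombine-comm (suc a) (suc b) = cong suc (rankCombine-comm a b)

≤-rankCombineˡ : ∀ a b → a ≤ rankCombine a b
≤-rankCombineˡ zero    b       = z≤n
≤-rankCombineˡ (suc a) zero    = ≤-refl
≤-rankCombineˡ (suc a) (suc b) = s≤s (≤-rankCombineˡ a b)

≤-rankCombineʳ : ∀ a b → b ≤ rankCombine a b
≤-rankCombineʳ a b rewrite rankCombine-comm a b = ≤-rankCombineˡ b a

1≤rankCombine : ∀ a b → 1 ≤ rankCombine a b
1≤rankCombine zero    zero    = s≤s z≤n
1≤rankCombine zero    (suc b) = s≤s z≤n
1≤rankCombine (suc a) zero    = s≤s z≤n
1≤rankCombine (suc a) (suc b) = s≤s z≤n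

<-rankCombine : ∀ a b → a < rankCombine a b ⊎ b < rankCombine a b
<-rankCombine zero    zero    = inj₁ ≤-refl
<-rankCombine zero    (suc b) = inj₁ (s≤s z≤n)
<-rankCombine (suc a) zero    = inj₂ (s≤s z≤n)
<-rankCombine (suc a) (suc b) with <-rankCombine a b
... | inj₁ a< = inj₁ (s≤s a<)
... | inj₂ b< = inj₂ (s≤s b<)

rankCombine-mono-≤ : ∀ {a a′ b b′} → a ≤ a′ → b ≤ b′ → rankCombine a b ≤ rankCombine a′ b′
rankCombine-mono-≤ {zero}  {a′} {zero}  {b′} _ _ = 1≤rankCombine a′ b′
rankCombine-mono-≤ {zero}  {a′} {suc b} {b′} _ b≤b′ = ≤-trans b≤b′ (≤-rankCombineʳ a′ b′)
rankCombine-mono-≤ {suc a} {a′} {zero}  {b′} a≤a′ _ = ≤-trans a≤a′ (≤-rankCombineˡ a′ b′)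
rankCombine-mono-≤ {suc a} {suc a′} {suc b} {suc b′} (s≤s a≤a′) (s≤s b≤b′) =
  s≤s (rankCombine-mono-≤ a≤a′ b≤b′)

rankCombine-≤-suc : ∀ {a b t} → a ≤ t → b ≤ t → rankCombine a b ≤ suc t
rankCombine-≤-suc {zero}  {zero}  _ _ = s≤s z≤n
rankCombine-≤-suc {zero}  {suc b} _ b≤t = m≤n⇒m≤1+n b≤t
rankCombine-≤-suc {suc a} {zero}  a≤t _ = m≤n⇒m≤1+n a≤t
rankCombine-≤-suc {suc a} {suc b} (s≤s a≤t) (s≤s b≤t) = s≤s (rankCombine-≤-suc a≤t b≤t)

rankCombine-≤ : ∀ {a b t} → a ≤ t → b < t → rankCombine a b ≤ t
rankCombine-≤ {zero}  {zero}  _ b<t = b<t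
rankCombine-≤ {zero}  {suc b} _ b<t = <⇒≤ b<t
rankCombine-≤ {suc a} {zero}  a≤t _ = a≤t
rankCombine-≤ {suc a} {suc b} (s≤s a≤t) (s≤s b<t) = s≤s (rankCombine-≤ a≤t b<t)

rankCombine-zeroˡ : ∀ b → rankCombine 0 b ≡ b ⊔ 1
rankCombine-zeroˡ zero    = refl
rankCombine-zeroˡ (suc b) = cong suc (sym (⊔-identityʳ b))

rankCombine-zeroʳ : ∀ a → rankCombine a 0 ≡ a ⊔ 1
rankCombine-zeroʳ a = trans (rankCombine-comm a 0) (rankCombine-zeroˡ a)

-- Upper-bound trees

module _ {V : Set} where

  infixr 5 _⟫_
  _⟫_ : DTree V → DTree V → DTree V
  leaf false    ⟫ c = leaf false
  leaf true     ⟫ c = c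
  query v l r   ⟫ c = query v (l ⟫ c) (r ⟫ c)

  eval-⟫ : ∀ T c x → eval (T ⟫ c) x ≡ eval T x ∧ eval c x
  eval-⟫ (leaf false)  c x = refl
  eval-⟫ (leaf true)   c x = refl
  eval-⟫ (query v l r) c x with x v
  ... | true  = eval-⟫ r c x
  ... | false = eval-⟫ l c x

  orTree : (k : ℕ) → (Fin k → V) → DTree V
  orTree zero    q = leaf false
  orTree (suc k) q = query (q zero) (orTree k (q ∘ suc)) (leaf true)

  eval-orTree : ∀ k q x → eval (orTree k q) x ≡ ORℕ k (x ∘ q)
  eval-orTree zero    q x = refl
  eval-orTree (suc k) q x with x (q zero)
  ... | true  = refl
  ... | false = eval-orTree k (q ∘ suc) x

  rank-orTree-⟫ : ∀ k q c → rank (orTree k q ⟫ c) ≤ suc (rank c)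
  rank-orTree-⟫ zero    q c = z≤n
  rank-orTree-⟫ (suc k) q c = rankCombine-≤ (rank-orTree-⟫ k (q ∘ suc) c) ≤-refl

  parityTree : (k : ℕ) → (Fin k → V) → Bool → DTree V
  parityTree zero    q t = leaf t
  parityTree (suc k) q t = query (q zero) (parityTree k (q ∘ suc) t) (parityTree k (q ∘ suc) (not t))

  eval-parityTree : ∀ k q t x → eval (parityTree k q t) x ≡ PARITYℕ k (x ∘ q) xor t
  eval-parityTree zero    q t x = refl
  eval-parityTree (suc k) q t x with x (q zero)
  ... | true  = trans (eval-parityTree k (q ∘ suc) (not t) x)
                     (trans (sym (not-distribʳ-xor p t)) (not-distribˡ-xor p t))
    where
    p : Bool
    p = PARITYℕ k (x ∘ q ∘ suc)
  ... | false = eval-parityTree k (q ∘ suc) t x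

  rank-parityTree-⟫ : ∀ k q t c → rank (parityTree (suc k) q t ⟫ c) ≤ k + (rank c ⊔ 1)
  rank-parityTree-⟫ zero    q true  c = ≤-reflexive (rankCombine-zeroʳ (rank c))
  rank-parityTree-⟫ zero    q false c = ≤-reflexive (rankCombine-zeroˡ (rank c))
  rank-parityTree-⟫ (suc k) q t     c =
    rankCombine-≤-suc (rank-parityTree-⟫ k (q ∘ suc) t c) (rank-parityTree-⟫ k (q ∘ suc) (not t) c)

  conjunction : (k : ℕ) → (Fin k → DTree V) → DTree V
  conjunction zero    g = leaf true
  conjunction (suc k) g = g zero ⟫ conjunction k (g ∘ suc)

  eval-conjunction : ∀ k g x → eval (conjunction k g) x ≡ ANDℕ k (λ i → eval (g i) x)
  eval-conjunction zero    g x = refl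
  eval-conjunction (suc k) g x =
    trans (eval-⟫ (g zero) _ x) (cong (eval (g zero) x ∧_) (eval-conjunction k (g ∘ suc) x))

  rank-conjunction : ∀ {a b} k (g : Fin k → DTree V) →
                     (∀ i c → rank (g i ⟫ c) ≤ a + (rank c ⊔ b)) → rank (conjunction k g) ≤ k * a + b
  rank-conjunction         zero    g gate = z≤n
  rank-conjunction {a} {b} (suc k) g gate = begin
    rank (g zero ⟫ rest)     ≤⟨ gate zero rest ⟩
    a + (rank rest ⊔ b)      ≤⟨ +-monoʳ-≤ a (⊔-lub (rank-conjunction k (g ∘ suc) (gate ∘ suc)) (m≤n+m b (k * a))) ⟩
    a + (k * a + b)          ≡⟨ +-assoc a (k * a) b ⟨
    suc k * a + b            ∎
    where
    open ≤-Reasoning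
    rest : DTree V
    rest = conjunction k (g ∘ suc)

-- Restrictions and the Prover–Delayer bound

height : {V : Set} → DTree V → ℕ
height (leaf _)      = 0
height (query _ l r) = suc (height l ⊔ height r)

module _ {V : Set} {{_ : IsDecEquivalence {A = V} _≡_}} where

  restrict : DTree V → V → Bool → DTree V
  restrict (leaf a)      v b = leaf a
  restrict (query w l r) v b =
    if does (w ≟ v) then (if b then restrict r v b else restrict l v b)
    else query w (restrict l v b) (restrict r v b)

  eval-restrict : ∀ T v b x → eval (restrict T v b) x ≡ eval T (x [ v ≔ b ])
  eval-restrict (leaf a)      v b x = refl
  eval-restrict (query w l r) v b x with w ≟ v
  ... | yes refl with b
  ...   | true  = eval-restrict r v true x
  ...   | false = eval-restrict l v false x
  eval-restrict (query w l r) v b x | no _ with x w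
  ...   | true  = eval-restrict r v b x
  ...   | false = eval-restrict l v b x

  rank-restrict : ∀ T v b → rank (restrict T v b) ≤ rank T
  rank-restrict (leaf a)      v b = z≤n
  rank-restrict (query w l r) v b with does (w ≟ v) | b
  ... | true  | true  = ≤-trans (rank-restrict r v true)  (≤-rankCombineʳ (rank l) (rank r))
  ... | true  | false = ≤-trans (rank-restrict l v false) (≤-rankCombineˡ (rank l) (rank r))
  ... | false | b′    = rankCombine-mono-≤ (rank-restrict l v b′) (rank-restrict r v b′)

  height-restrict : ∀ T v b → height (restrict T v b) ≤ height T
  height-restrict (leaf a)      v b = z≤n
  height-restrict (query w l r) v b with does (w ≟ v) | b
  ... | true  | true  = ≤-trans (height-restrict r v true)  (m≤n⇒m≤1+n (m≤n⊔m (height l) (height r)))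
  ... | true  | false = ≤-trans (height-restrict l v false) (m≤n⇒m≤1+n (m≤m⊔n (height l) (height r)))
  ... | false | b′    = s≤s (⊔-mono-≤ (height-restrict l v b′) (height-restrict r v b′))

module _ {V : Set} where

  eval-query : ∀ {v : V} {l r x b} → x v ≡ b → eval (query v l r) x ≡ eval (if b then r else l) x
  eval-query {b = true}  xv≡b rewrite xv≡b = refl
  eval-query {b = false} xv≡b rewrite xv≡b = refl

  height-child : ∀ (l r : DTree V) b → height (if b then r else l) ≤ height l ⊔ height r
  height-child l r true  = m≤n⊔m (height l) (height r)
  height-child l r false = m≤m⊔n (height l) (height r)

  rank-child : ∀ v (l r : DTree V) b → rank (if b then r else l) ≤ rank (query v l r)
  rank-child v l r true  = ≤-rankCombineʳ (rank l) (rank r)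
  rank-child v l r false = ≤-rankCombineˡ (rank l) (rank r)

  rank-child-< : ∀ v (l r : DTree V) → ∃ λ b → rank (if b then r else l) < rank (query v l r)
  rank-child-< v l r with <-rankCombine (rank l) (rank r)
  ... | inj₁ l< = false , l<
  ... | inj₂ r< = true  , r<

module Adversary {V : Set} {{_ : IsDecEquivalence {A = V} _≡_}} {S : Set}
                 (⟦_⟧ : S → (V → Bool) → Bool) (potential : S → ℕ) where

  Restricts : S → V → Bool → S → Set
  Restricts s v b s′ = ∀ x → ⟦ s′ ⟧ x ≡ ⟦ s ⟧ (x [ v ≔ b ])

  data Answer (s : S) (v : V) : Set where
    fix    : ∀ b s′ → Restricts s v b s′ → potential s ≤ potential s′ → Answer s v
    branch : ∀ (s′ : Bool → S) → (∀ b → Restricts s v b (s′ b)) →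
             (∀ b → potential s ≤ suc (potential (s′ b))) → Answer s v

  module _ (answer : ∀ s v → potential s ≤ 1 ⊎ Answer s v)
           (nonconstant : ∀ s → 1 ≤ potential s → ∃₂ λ x y → ⟦ s ⟧ x ≢ ⟦ s ⟧ y) where

    -- The child followed is restricted so that it computes the restricted function
    -- everywhere; it is then no longer a subterm, hence the induction on height.
    potential≤rank : ∀ s T → Computes T ⟦ s ⟧ → potential s ≤ rank T
    potential≤rank s T = bounded (height T) s T ≤-refl
      where
      bounded : ∀ h s T → height T ≤ h → Computes T ⟦ s ⟧ → potential s ≤ rank T
      bounded h s (leaf a) _ T≡s with 1 ≤? potential s
      ... | no  p≱1 = ≤-pred (≰⇒> p≱1)
      ... | yes p≥1 with nonconstant s p≥1
      ...   | x , y , sx≢sy = ⊥-elim (sx≢sy (trans (sym (T≡s x)) (T≡s y)))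
      bounded (suc h) s (query v l r) (s≤s hl⊔hr≤h) T≡s = byAnswer (answer s v)
        where
        sub : ∀ {b s′} → Restricts s v b s′ → potential s′ ≤ rank (if b then r else l)
        sub {b} {s′} rs = ≤-trans (bounded h s′ (restrict child v b) child-height child-computes)
                                  (rank-restrict child v b)
          where
          child : DTree V
          child = if b then r else l
          child-height : height (restrict child v b) ≤ h
          child-height = ≤-trans (height-restrict child v b) (≤-trans (height-child l r b) hl⊔hr≤h)
          child-computes : Computes (restrict child v b) ⟦ s′ ⟧
          child-computes x = begin
            eval (restrict child v b) x      ≡⟨ eval-restrict child v b x ⟩
            eval child (x [ v ≔ b ])         ≡⟨ eval-query (update-same x v b) ⟨
            eval (query v l r) (x [ v ≔ b ]) ≡⟨ T≡s (x [ v ≔ b ]) ⟩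
            ⟦ s ⟧ (x [ v ≔ b ])              ≡⟨ rs x ⟨
            ⟦ s′ ⟧ x                         ∎
            where open ≡-Reasoning

        byAnswer : potential s ≤ 1 ⊎ Answer s v → potential s ≤ rank (query v l r)
        byAnswer (inj₁ p≤1)                   = ≤-trans p≤1 (1≤rankCombine (rank l) (rank r))
        byAnswer (inj₂ (fix b s′ rs p≤p′))    = ≤-trans p≤p′ (≤-trans (sub rs) (rank-child v l r b))
        byAnswer (inj₂ (branch s′ rs p≤1+p′)) with rank-child-< v l r
        ... | b , child< = ≤-trans (p≤1+p′ b) (≤-trans (s≤s (sub (rs b))) child<)

sum-const : ∀ n c → sum {n} (const c) ≡ n * c
sum-const zero    c = refl
sum-const (suc n) c = cong (c +_) (sum-const n c)

sum-zero : ∀ {n} (t : Vector ℕ n) → (∀ i → t i ≡ 0) → sum t ≡ 0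
sum-zero {n} t t≗0 = trans (sum-cong-≗ t≗0) (trans (sum-const n 0) (*-zeroʳ n))

sum-positive : ∀ {n} (t : Vector ℕ n) → 1 ≤ sum t → ∃ λ i → 1 ≤ t i
sum-positive {suc n} t 1≤∑t with t zero in t₀≡
... | suc _ = zero , subst (1 ≤_) (sym t₀≡) (s≤s z≤n)
... | zero with sum-positive (t ∘ suc) 1≤∑t
...   | i , 1≤tᵢ = suc i , 1≤tᵢ

sum-except : ∀ {n} (t u : Vector ℕ n) i → (∀ k → k ≢ i → u k ≡ t k) → sum t + u i ≡ sum u + t i
sum-except {suc n} t u zero    same = begin
  (t zero + sum (t ∘ suc)) + u zero ≡⟨ cong (λ ∑ → (t zero + ∑) + u zero) tails-agree ⟨
  (t zero + sum (u ∘ suc)) + u zero ≡⟨ swap-outer (t zero) (sum (u ∘ suc)) (u zero) ⟩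
  (u zero + sum (u ∘ suc)) + t zero ∎
  where
  open ≡-Reasoning
  tails-agree : sum (u ∘ suc) ≡ sum (t ∘ suc)
  tails-agree = sum-cong-≗ (λ k → same (suc k) λ ())
  swap-outer : ∀ a b c → (a + b) + c ≡ (c + b) + a
  swap-outer = solve-∀
sum-except {suc n} t u (suc i) same = begin
  (t zero + sum (t ∘ suc)) + u (suc i) ≡⟨ +-assoc (t zero) _ _ ⟩
  t zero + (sum (t ∘ suc) + u (suc i)) ≡⟨ cong (t zero +_) tails-except ⟩
  t zero + (sum (u ∘ suc) + t (suc i)) ≡⟨ +-assoc (t zero) _ _ ⟨
  (t zero + sum (u ∘ suc)) + t (suc i) ≡⟨ cong (λ a → (a + sum (u ∘ suc)) + t (suc i)) (same zero λ ()) ⟨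
  (u zero + sum (u ∘ suc)) + t (suc i) ∎
  where
  open ≡-Reasoning
  tails-except : sum (t ∘ suc) + u (suc i) ≡ sum (u ∘ suc) + t (suc i)
  tails-except = sum-except (t ∘ suc) (u ∘ suc) i λ k k≢i → same (suc k) (k≢i ∘ Fin-suc-injective)

sum-updateAt-≤ : ∀ {A : Set} {n} (p : A → ℕ) (s : Vector A n) i a d →
                 p (s i) ≤ d + p a → sum (p ∘ s) ≤ d + sum (p ∘ updateAt s i (const a))
sum-updateAt-≤ {A} {n} p s i a d pᵢ≤d+pa = +-cancelʳ-≤ (p a) _ _ (begin
  sum (p ∘ s) + p a        ≡⟨ cong (sum (p ∘ s) +_) (cong p (updateAt-updates i s)) ⟨
  sum (p ∘ s) + p (s′ i)   ≡⟨ sum-except (p ∘ s) (p ∘ s′) i (λ k k≢i → cong p (updateAt-minimal k i s k≢i)) ⟩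
  sum (p ∘ s′) + p (s i)   ≤⟨ +-monoʳ-≤ (sum (p ∘ s′)) pᵢ≤d+pa ⟩
  sum (p ∘ s′) + (d + p a) ≡⟨ rearrange (sum (p ∘ s′)) d (p a) ⟩
  (d + sum (p ∘ s′)) + p a ∎)
  where
  open ≤-Reasoning
  s′ : Vector A n
  s′ = updateAt s i (const a)
  rearrange : ∀ a b c → a + (b + c) ≡ (b + a) + c
  rearrange = solve-∀

module Rows (n m : ℕ) {R : Set} (⟦_⟧ʳ : R → (Fin m → Bool) → Bool)
            (⟦⟧ʳ-cong : ∀ r {y z} → y ≗ z → ⟦ r ⟧ʳ y ≡ ⟦ r ⟧ʳ z) where

  row : Fin n → (Var n m → Bool) → Fin m → Bool
  row i x j = x (i , j)

  ⟦_⟧ : (Fin n → R) → (Var n m → Bool) → Bool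
  ⟦ s ⟧ x = ANDℕ n (λ i → ⟦ s i ⟧ʳ (row i x))

  row-update-same : ∀ x i j b → row i (x [ (i , j) ≔ b ]) ≗ row i x [ j ≔ b ]
  row-update-same x i j b l with l ≟ j
  ... | yes refl = update-same x (i , l) b
  ... | no l≢j   = update-other x b (l≢j ∘ cong proj₂)

  row-update-other : ∀ x {i k} j b → k ≢ i → row k (x [ (i , j) ≔ b ]) ≗ row k x
  row-update-other x j b k≢i l = update-other x b (k≢i ∘ cong proj₁)

  restrict-row : ∀ s i j b r → (∀ y → ⟦ r ⟧ʳ y ≡ ⟦ s i ⟧ʳ (y [ j ≔ b ])) →
                 ∀ x → ⟦ updateAt s i (const r) ⟧ x ≡ ⟦ s ⟧ (x [ (i , j) ≔ b ])
  restrict-row s i j b r r≡sᵢ∣ x = ANDℕ-cong n rowwise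
    where
    rowwise : ∀ k → ⟦ updateAt s i (const r) k ⟧ʳ (row k x) ≡ ⟦ s k ⟧ʳ (row k (x [ (i , j) ≔ b ]))
    rowwise k = [ same-row , other-row ]′ (toSum (k ≟ i))
      where
      same-row : k ≡ i → ⟦ updateAt s i (const r) k ⟧ʳ (row k x) ≡ ⟦ s k ⟧ʳ (row k (x [ (i , j) ≔ b ]))
      same-row refl = begin
        ⟦ updateAt s k (const r) k ⟧ʳ (row k x) ≡⟨ cong (λ r → ⟦ r ⟧ʳ (row k x)) (updateAt-updates k s) ⟩
        ⟦ r ⟧ʳ (row k x)                         ≡⟨ r≡sᵢ∣ (row k x) ⟩
        ⟦ s k ⟧ʳ (row k x [ j ≔ b ])             ≡⟨ ⟦⟧ʳ-cong (s k) (row-update-same x k j b) ⟨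
        ⟦ s k ⟧ʳ (row k (x [ (k , j) ≔ b ]))     ∎
        where open ≡-Reasoning
      other-row : k ≢ i → ⟦ updateAt s i (const r) k ⟧ʳ (row k x) ≡ ⟦ s k ⟧ʳ (row k (x [ (i , j) ≔ b ]))
      other-row k≢i = trans (cong (λ r → ⟦ r ⟧ʳ (row k x)) (updateAt-minimal k i s k≢i))
                            (sym (⟦⟧ʳ-cong (s k) (row-update-other x j b k≢i)))

  restrict-unchanged : ∀ s i j b → (∀ y → ⟦ s i ⟧ʳ y ≡ ⟦ s i ⟧ʳ (y [ j ≔ b ])) →
                       ∀ x → ⟦ s ⟧ x ≡ ⟦ s ⟧ (x [ (i , j) ≔ b ])
  restrict-unchanged s i j b sᵢ≡sᵢ∣ x =
    trans (sym (ANDℕ-cong n λ k → cong (λ r → ⟦ r ⟧ʳ (row k x)) (updateAt-id-local i s refl k)))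
          (restrict-row s i j b (s i) sᵢ≡sᵢ∣ x)

  nonconstant : ∀ s i → (∀ k → ∃ λ y → ⟦ s k ⟧ʳ y ≡ true) → (∃ λ y → ⟦ s i ⟧ʳ y ≡ false) →
                ∃₂ λ x x′ → ⟦ s ⟧ x ≢ ⟦ s ⟧ x′
  nonconstant s i sat (y⁻ , refuted) =
    uncurry y⁺ , uncurry y± , λ eq → true≢false (trans (sym accepted) (trans eq rejected))
    where
    y⁺ : Fin n → Fin m → Bool
    y⁺ k = proj₁ (sat k)
    y± : Fin n → Fin m → Bool
    y± = updateAt y⁺ i (const y⁻)
    accepted : ⟦ s ⟧ (uncurry y⁺) ≡ true
    accepted = ANDℕ-true n (proj₂ ∘ sat)
    rejected : ⟦ s ⟧ (uncurry y±) ≡ false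
    rejected = ANDℕ-false n i (trans (cong ⟦ s i ⟧ʳ (updateAt-updates i y⁺)) refuted)
    true≢false : true ≢ false
    true≢false ()

  liftAnswer : (p : R → ℕ) → ∀ {s i j} → Adversary.Answer ⟦_⟧ʳ p (s i) j →
               Adversary.Answer ⟦_⟧ (λ s → sum (p ∘ s)) s (i , j)
  liftAnswer p {s} {i} {j} (Adversary.fix b r r≡sᵢ∣ pᵢ≤) =
    Adversary.fix b (updateAt s i (const r)) (restrict-row s i j b r r≡sᵢ∣) (sum-updateAt-≤ p s i r 0 pᵢ≤)
  liftAnswer p {s} {i} {j} (Adversary.branch r r≡sᵢ∣ pᵢ≤) =
    Adversary.branch (λ b → updateAt s i (const (r b))) (λ b → restrict-row s i j b (r b) (r≡sᵢ∣ b))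
                     (λ b → sum-updateAt-≤ p s i (r b) 1 (pᵢ≤ b))

-- AND of OR clauses

data OrRow (m : ℕ) : Set where
  untouched : OrRow m
  zeroAt    : Fin m → OrRow m
  satisfied : OrRow m

⟦_⟧∨ : ∀ {m} → OrRow m → (Fin m → Bool) → Bool
⟦_⟧∨ {m} untouched  y = ORℕ m y
⟦_⟧∨ {m} (zeroAt j) y = ORℕ m (y [ j ≔ false ])
⟦ satisfied ⟧∨      y = true

⟦⟧∨-cong : ∀ {m} (r : OrRow m) {y z} → y ≗ z → ⟦ r ⟧∨ y ≡ ⟦ r ⟧∨ z
⟦⟧∨-cong {m} untouched  y≗z = ORℕ-cong m y≗z
⟦⟧∨-cong {m} (zeroAt j) y≗z = ORℕ-cong m (update-cong j false y≗z)
⟦⟧∨-cong satisfied      y≗z = refl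

fresh : ∀ {m} → OrRow m → ℕ
fresh untouched  = 1
fresh (zeroAt _) = 0
fresh satisfied  = 0

orMove : ∀ {m} (r : OrRow m) j → Adversary.Answer ⟦_⟧∨ fresh r j
orMove {m} untouched j = Adversary.branch (λ b → if b then satisfied else zeroAt j) restricts (λ _ → s≤s z≤n)
  where
  restricts : ∀ b y → ⟦ if b then satisfied else zeroAt j ⟧∨ y ≡ ORℕ m (y [ j ≔ b ])
  restricts false y = refl
  restricts true  y = sym (ORℕ-true m j (update-same y j true))
orMove {m} (zeroAt k) j with j ≟ k
... | yes refl = Adversary.fix false (zeroAt j) (λ y → sym (ORℕ-cong m (update-update y j false false))) ≤-refl
... | no j≢k   = Adversary.fix true satisfied
                   (λ y → sym (ORℕ-true m {y [ j ≔ true ] [ k ≔ false ]} j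
                                  (trans (update-other (y [ j ≔ true ]) false j≢k) (update-same y j true)))) z≤n
orMove satisfied j = Adversary.fix true satisfied (λ _ → refl) ≤-refl

orRow-satisfiable : ∀ {m} (r : OrRow (suc (suc m))) → ∃ λ y → ⟦ r ⟧∨ y ≡ true
orRow-satisfiable untouched  = const true , refl
orRow-satisfiable (zeroAt j) =
  const true , ORℕ-true _ {const true [ j ≔ false ]} (punchIn j zero)
                         (update-other (const true) false (punchInᵢ≢i j zero))
orRow-satisfiable satisfied  = const true , refl

fresh-refutable : ∀ {m} (r : OrRow m) → 1 ≤ fresh r → ∃ λ y → ⟦ r ⟧∨ y ≡ false
fresh-refutable {m} untouched _ = const false , ORℕ-false m

module _ (n m : ℕ) where
  open Rows n (suc (suc m)) ⟦_⟧∨ ⟦⟧∨-cong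
  open Adversary ⟦_⟧ (λ s → sum (fresh ∘ s)) using (Answer; potential≤rank)

  TRIBESd-rank-≥ : ∀ T → Computes T (TRIBESd n (suc (suc m))) → n ≤ rank T
  TRIBESd-rank-≥ T T≡f =
    subst (_≤ rank T) fresh-count (potential≤rank answer state-nonconstant (const untouched) T T≡f)
    where
    answer : ∀ s v → sum (fresh ∘ s) ≤ 1 ⊎ Answer s v
    answer s (i , j) = inj₂ (liftAnswer fresh (orMove (s i) j))
    state-nonconstant : ∀ s → 1 ≤ sum (fresh ∘ s) → ∃₂ λ x y → ⟦ s ⟧ x ≢ ⟦ s ⟧ y
    state-nonconstant s 1≤∑ with sum-positive (fresh ∘ s) 1≤∑
    ... | i , 1≤freshᵢ = nonconstant s i (orRow-satisfiable ∘ s) (fresh-refutable (s i) 1≤freshᵢ)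
    fresh-count : sum {n} (const 1) ≡ n
    fresh-count = trans (sum-const n 1) (*-identityʳ n)

-- AND of parities

Partial : ℕ → Set
Partial m = Fin m → Maybe Bool

infixl 8 _◃_
_◃_ : ∀ {m} → Partial m → (Fin m → Bool) → Fin m → Bool
(ρ ◃ y) j = fromMaybe (y j) (ρ j)

unassigned : Maybe Bool → ℕ
unassigned = maybe′ (const 0) 1

#free : ∀ {m} → Partial m → ℕ
#free ρ = sum (unassigned ∘ ρ)

parityOf : ∀ {m} → Partial m → (Fin m → Bool) → Bool
parityOf {m} ρ y = PARITYℕ m (ρ ◃ y)

module _ {m : ℕ} (ρ : Partial m) where

  parityOf-cong : ∀ {y z} → y ≗ z → parityOf ρ y ≡ parityOf ρ z
  parityOf-cong y≗z = PARITYℕ-cong m (λ l → cong (λ a → fromMaybe a (ρ l)) (y≗z l))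

  parityOf-fixed : ∀ y {j c} b → ρ j ≡ just c → parityOf ρ (y [ j ≔ b ]) ≡ parityOf ρ y
  parityOf-fixed y {j} b ρⱼ≡c = PARITYℕ-cong m agree
    where
    agree : ρ ◃ (y [ j ≔ b ]) ≗ ρ ◃ y
    agree l with l ≟ j
    ... | yes refl rewrite ρⱼ≡c = refl
    ... | no _     = refl

  parityOf-assign : ∀ y {j} b → ρ j ≡ nothing → parityOf (ρ [ j ≔ just b ]) y ≡ parityOf ρ (y [ j ≔ b ])
  parityOf-assign y {j} b ρⱼ≡nothing = PARITYℕ-cong m agree
    where
    agree : (ρ [ j ≔ just b ]) ◃ y ≗ ρ ◃ (y [ j ≔ b ])
    agree l with l ≟ j
    ... | yes refl rewrite ρⱼ≡nothing = refl
    ... | no _     = refl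

  parityOf-flip : ∀ y {j} → ρ j ≡ nothing → parityOf ρ (y [ j ≔ not (y j) ]) ≡ not (parityOf ρ y)
  parityOf-flip y {j} ρⱼ≡nothing = PARITYℕ-flip m j unchanged flipped
    where
    unchanged : ∀ l → l ≢ j → (ρ ◃ y [ j ≔ not (y j) ]) l ≡ (ρ ◃ y) l
    unchanged l l≢j = cong (λ a → fromMaybe a (ρ l)) (update-other y _ l≢j)
    flipped : (ρ ◃ y [ j ≔ not (y j) ]) j ≡ not ((ρ ◃ y) j)
    flipped rewrite ρⱼ≡nothing = update-same y j (not (y j))

  parityOf-attains : ∀ {j} → ρ j ≡ nothing → ∀ t → ∃ λ y → parityOf ρ y ≡ t
  parityOf-attains {j} ρⱼ≡nothing t with parityOf ρ (const false) ≟ t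
  ... | yes p≡t = const false , p≡t
  ... | no  p≢t = const false [ j ≔ true ] ,
                  trans (parityOf-flip (const false) ρⱼ≡nothing) (sym (¬-not (p≢t ∘ sym)))

  #free-assign : ∀ {j} b → ρ j ≡ nothing → #free ρ ≡ suc (#free (ρ [ j ≔ just b ]))
  #free-assign {j} b ρⱼ≡nothing = begin
    sum t         ≡⟨ +-identityʳ _ ⟨
    sum t + 0     ≡⟨ cong (λ a → sum t + unassigned a) (update-same ρ j (just b)) ⟨
    sum t + t′ j  ≡⟨ sum-except t t′ j (λ k k≢j → cong unassigned (update-other ρ _ k≢j)) ⟩
    sum t′ + t j  ≡⟨ cong (λ a → sum t′ + unassigned a) ρⱼ≡nothing ⟩
    sum t′ + 1    ≡⟨ +-comm _ 1 ⟩
    suc (sum t′)  ∎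
    where
    open ≡-Reasoning
    t t′ : Fin m → ℕ
    t  = unassigned ∘ ρ
    t′ = unassigned ∘ (ρ [ j ≔ just b ])

  #free-positive : 1 ≤ #free ρ → ∃ λ j → ρ j ≡ nothing
  #free-positive 1≤#free with sum-positive (unassigned ∘ ρ) 1≤#free
  ... | j , 1≤ = j , unassigned-positive (ρ j) 1≤
    where
    unassigned-positive : ∀ a → 1 ≤ unassigned a → a ≡ nothing
    unassigned-positive nothing _ = refl

ParityRow : ℕ → Set
ParityRow m = Σ (Partial m) λ ρ → ∃ λ y → parityOf ρ y ≡ true

excess : ∀ {m} → ParityRow m → ℕ
excess (ρ , _) = #free ρ ∸ 1

module ParityGame (n m : ℕ) where
  open Rows n m {ParityRow m} (parityOf ∘ proj₁) (parityOf-cong ∘ proj₁)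

  HasFree : (Fin n → ParityRow m) → Set
  HasFree s = ∃₂ λ i j → proj₁ (s i) j ≡ nothing

  State : Set
  State = Σ (Fin n → ParityRow m) HasFree

  potential : State → ℕ
  potential (s , _) = suc (sum (excess ∘ s))

  open Adversary (⟦_⟧ ∘ proj₁) potential public

  module _ (s : Fin n → ParityRow m) (hf : HasFree s) (i : Fin n) (j : Fin m) where
    private
      ρ : Partial m
      ρ = proj₁ (s i)

    fixedAt : ∀ {c} → ρ j ≡ just c → Answer (s , hf) (i , j)
    fixedAt {c} ρⱼ≡c = fix c (s , hf) (restrict-unchanged s i j c λ y → sym (parityOf-fixed ρ y c ρⱼ≡c)) ≤-refl

    branchAt : ρ j ≡ nothing → 2 ≤ #free ρ → Answer (s , hf) (i , j)
    branchAt ρⱼ≡nothing 2≤#free = branch (λ b → s′ b , still-free b) restricts potential-drop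
      where
      free′ : ∀ b → ∃ λ l → (ρ [ j ≔ just b ]) l ≡ nothing
      free′ b = #free-positive _ (≤-pred (subst (2 ≤_) (#free-assign ρ b ρⱼ≡nothing) 2≤#free))
      row′ : Bool → ParityRow m
      row′ b = ρ [ j ≔ just b ] , parityOf-attains (ρ [ j ≔ just b ]) (proj₂ (free′ b)) true
      s′ : Bool → Fin n → ParityRow m
      s′ b = updateAt s i (const (row′ b))
      still-free : ∀ b → HasFree (s′ b)
      still-free b = i , proj₁ (free′ b) ,
                     trans (cong (λ r → proj₁ r (proj₁ (free′ b))) (updateAt-updates i s)) (proj₂ (free′ b))
      restricts : ∀ b → Restricts (s , hf) (i , j) b (s′ b , still-free b)
      restricts b = restrict-row s i j b (row′ b) (λ y → parityOf-assign ρ y b ρⱼ≡nothing)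
      potential-drop : ∀ b → potential (s , hf) ≤ suc (potential (s′ b , still-free b))
      potential-drop b = s≤s (sum-updateAt-≤ excess s i (row′ b) 1 (begin
        #free ρ ∸ 1                         ≡⟨ cong (_∸ 1) (#free-assign ρ b ρⱼ≡nothing) ⟩
        #free (ρ [ j ≔ just b ])            ≤⟨ m≤n+m∸n _ 1 ⟩
        1 + (#free (ρ [ j ≔ just b ]) ∸ 1) ∎))
        where open ≤-Reasoning

    completeAt : ρ j ≡ nothing → #free ρ ≤ 1 → ∀ {k} → k ≢ i → 1 ≤ #free (proj₁ (s k)) →
                 Answer (s , hf) (i , j)
    completeAt ρⱼ≡nothing #free≤1 {k} k≢i 1≤#freeₖ = fix b (s′ , other-free) restricts potential-kept
      where
      y : Fin m → Bool
      y = proj₁ (proj₂ (s i))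
      b : Bool
      b = y j
      sat : parityOf (ρ [ j ≔ just b ]) y ≡ true
      sat = trans (parityOf-assign ρ y b ρⱼ≡nothing) (trans (parityOf-cong ρ (update-self y j)) (proj₂ (proj₂ (s i))))
      s′ : Fin n → ParityRow m
      s′ = updateAt s i (const (ρ [ j ≔ just b ] , y , sat))
      other-free : HasFree s′
      other-free with #free-positive (proj₁ (s k)) 1≤#freeₖ
      ... | l , free = k , l , trans (cong (λ r → proj₁ r l) (updateAt-minimal k i s k≢i)) free
      restricts : Restricts (s , hf) (i , j) b (s′ , other-free)
      restricts = restrict-row s i j b _ (λ y → parityOf-assign ρ y b ρⱼ≡nothing)
      potential-kept : potential (s , hf) ≤ potential (s′ , other-free)
      potential-kept = s≤s (sum-updateAt-≤ excess s i _ 0 (≤-trans (≤-reflexive (m≤n⇒m∸n≡0 #free≤1)) z≤n))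

    resignAt : #free ρ ≤ 1 → (∀ {k} → k ≢ i → #free (proj₁ (s k)) ≡ 0) → potential (s , hf) ≤ 1
    resignAt #free≤1 others-full = s≤s (≤-reflexive (sum-zero (excess ∘ s) no-excess))
      where
      no-excess : ∀ k → excess (s k) ≡ 0
      no-excess k with k ≟ i
      ... | yes refl = m≤n⇒m∸n≡0 #free≤1
      ... | no k≢i   = cong (_∸ 1) (others-full k≢i)

    lastFreeAt : ρ j ≡ nothing → #free ρ ≤ 1 → potential (s , hf) ≤ 1 ⊎ Answer (s , hf) (i , j)
    lastFreeAt ρⱼ≡nothing #free≤1 with any? (λ k → ¬? (k ≟ i) ×-dec 1 ≤? #free (proj₁ (s k)))
    ... | yes (k , k≢i , 1≤#freeₖ) = inj₂ (completeAt ρⱼ≡nothing #free≤1 k≢i 1≤#freeₖ)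
    ... | no  none = inj₁ (resignAt #free≤1 λ {k} k≢i → n<1⇒n≡0 (≰⇒> λ 1≤#freeₖ → none (k , k≢i , 1≤#freeₖ)))

  answer : ∀ σ v → potential σ ≤ 1 ⊎ Answer σ v
  answer (s , hf) (i , j) with proj₁ (s i) j in ρⱼ≡
  ... | just c  = inj₂ (fixedAt s hf i j ρⱼ≡)
  ... | nothing with 2 ≤? #free (proj₁ (s i))
  ...   | yes 2≤#free = inj₂ (branchAt s hf i j ρⱼ≡ 2≤#free)
  ...   | no  2≰#free = lastFreeAt s hf i j ρⱼ≡ (≤-pred (≰⇒> 2≰#free))

  state-nonconstant : ∀ σ → 1 ≤ potential σ → ∃₂ λ x y → ⟦ proj₁ σ ⟧ x ≢ ⟦ proj₁ σ ⟧ y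
  state-nonconstant (s , i , j , free) _ = nonconstant s i (proj₂ ∘ s) (parityOf-attains (proj₁ (s i)) free false)

ANDPARITY-rank-≥ : ∀ n m → ∀ T → Computes T (ANDPARITY (suc n) (suc m)) → suc n * m + 1 ≤ rank T
ANDPARITY-rank-≥ n m T T≡f = subst (_≤ rank T) potential₀ (potential≤rank answer state-nonconstant σ₀ T T≡f)
  where
  open ParityGame (suc n) (suc m)
  σ₀ : State
  σ₀ = const (const nothing , parityOf-attains (const nothing) {zero} refl true) , zero , zero , refl
  potential₀ : potential σ₀ ≡ suc n * m + 1
  potential₀ = begin
    suc (sum {suc n} (const (sum {m} (const 1)))) ≡⟨ cong suc (sum-const (suc n) _) ⟩
    suc (suc n * sum {m} (const 1))               ≡⟨ cong (λ a → suc (suc n * a)) row-count ⟩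
    suc (suc n * m)                               ≡⟨ +-comm 1 _ ⟩
    suc n * m + 1                                 ∎
    where
    open ≡-Reasoning
    row-count : sum {m} (const 1) ≡ m
    row-count = trans (sum-const m 1) (*-identityʳ m)

module _ {V : Set} where

  dual : DTree V → DTree V
  dual (leaf a)      = leaf (not a)
  dual (query v l r) = query v (dual r) (dual l)

  eval-dual : ∀ T x → eval (dual T) x ≡ not (eval T (not ∘ x))
  eval-dual (leaf a)      x = refl
  eval-dual (query v l r) x with x v
  ... | true  = eval-dual l x
  ... | false = eval-dual r x

  rank-dual : ∀ T → rank (dual T) ≡ rank T
  rank-dual (leaf a)      = refl
  rank-dual (query v l r) = trans (cong₂ rankCombine (rank-dual r) (rank-dual l)) (rankCombine-comm (rank r) (rank l))

  Dual : ((V → Bool) → Bool) → ((V → Bool) → Bool) → Set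
  Dual f g = ∀ x → g x ≡ not (f (not ∘ x))

  computes-dual : ∀ {f g} T → Dual f g → Computes T f → Computes (dual T) g
  computes-dual T g≡f* T≡f x = trans (eval-dual T x) (trans (cong not (T≡f (not ∘ x))) (sym (g≡f* x)))

  RankIs-dual : ∀ {f g r} → Dual f g → Dual g f → RankIs f r → RankIs g r
  RankIs-dual {f} {g} {r} g≡f* f≡g* ((T , T≡f , rankT≡r) , lower) =
    (dual T , computes-dual {f} {g} T g≡f* T≡f , trans (rank-dual T) rankT≡r) ,
    λ T′ T′≡g → subst (r ≤_) (rank-dual T′) (lower (dual T′) (computes-dual {g} {f} T′ f≡g* T′≡g))

  RankIs-intro : ∀ {f r} (T : DTree V) → Computes T f → rank T ≤ r →
                 (∀ T → Computes T f → r ≤ rank T) → RankIs f r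
  RankIs-intro T T≡f rankT≤r lower = (T , T≡f , ≤-antisym rankT≤r (lower T T≡f)) , lower

TRIBES-dual : ∀ n m → Dual (TRIBESd n m) (TRIBES n m)
TRIBES-dual n m x = sym (trans (cong not (begin
  ANDℕ n (λ i → ORℕ m (λ j → not (x (i , j)))) ≡⟨ ANDℕ-cong n (λ i → ORℕ-deMorgan m (λ j → x (i , j))) ⟩
  ANDℕ n (λ i → not (ANDℕ m (λ j → x (i , j)))) ≡⟨ ANDℕ-deMorgan n (λ i → ANDℕ m (λ j → x (i , j))) ⟩
  not (TRIBES n m x)                             ∎)) (not-involutive _))
  where open ≡-Reasoning

TRIBESd-dual : ∀ n m → Dual (TRIBES n m) (TRIBESd n m)
TRIBESd-dual n m x = sym (trans (cong not (begin
  ORℕ n (λ i → ANDℕ m (λ j → not (x (i , j)))) ≡⟨ ORℕ-cong n (λ i → ANDℕ-deMorgan m (λ j → x (i , j))) ⟩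
  ORℕ n (λ i → not (ORℕ m (λ j → x (i , j)))) ≡⟨ ORℕ-deMorgan n (λ i → ORℕ m (λ j → x (i , j))) ⟩
  not (TRIBESd n m x)                          ∎)) (not-involutive _))
  where open ≡-Reasoning

TRIBESd-rank : ∀ n m → 2 ≤ m → RankIs (TRIBESd n m) n
TRIBESd-rank n (suc (suc m)) (s≤s (s≤s z≤n)) = RankIs-intro tree tree≡f rank≤n (TRIBESd-rank-≥ n m)
  where
  gate : Fin n → DTree (Var n (suc (suc m)))
  gate i = orTree (suc (suc m)) (i ,_)
  tree : DTree (Var n (suc (suc m)))
  tree = conjunction n gate
  tree≡f : Computes tree (TRIBESd n (suc (suc m)))
  tree≡f x = trans (eval-conjunction n gate x) (ANDℕ-cong n λ i → eval-orTree _ (i ,_) x)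
  gate-rank : ∀ i c → rank (gate i ⟫ c) ≤ 1 + (rank c ⊔ 0)
  gate-rank i c = subst (rank (gate i ⟫ c) ≤_) (cong suc (sym (⊔-identityʳ (rank c))))
                        (rank-orTree-⟫ (suc (suc m)) (i ,_) c)
  rank≤n : rank tree ≤ n
  rank≤n = subst (rank tree ≤_) (trans (+-identityʳ _) (*-identityʳ n)) (rank-conjunction n gate gate-rank)

ANDPARITY-rank : ∀ n m → 1 ≤ n → 1 ≤ m → RankIs (ANDPARITY n m) (n * (m ∸ 1) + 1)
ANDPARITY-rank (suc n) (suc m) (s≤s z≤n) (s≤s z≤n) = RankIs-intro tree tree≡f rank≤ (ANDPARITY-rank-≥ n m)
  where
  gate : Fin (suc n) → DTree (Var (suc n) (suc m))
  gate i = parityTree (suc m) (i ,_) false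
  tree : DTree (Var (suc n) (suc m))
  tree = conjunction (suc n) gate
  tree≡f : Computes tree (ANDPARITY (suc n) (suc m))
  tree≡f x = trans (eval-conjunction (suc n) gate x)
                   (ANDℕ-cong (suc n) λ i → trans (eval-parityTree (suc m) (i ,_) false x)
                                                  (xor-identityʳ (PARITYℕ (suc m) (λ j → x (i , j)))))
  rank≤ : rank tree ≤ suc n * m + 1
  rank≤ = rank-conjunction (suc n) gate λ i → rank-parityTree-⟫ m (i ,_) false

theorem4p1 : ∀ (n : ℕ) → 1 ≤ n →
    (∀ (m : ℕ) → 2 ≤ m → RankIs (TRIBES n m) n × RankIs (TRIBESd n m) n)
    × (∀ (m : ℕ) → 1 ≤ m → RankIs (ANDPARITY n m) (n * (m ∸ 1) + 1))
theorem4p1 n 1≤n =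
  (λ m 2≤m → RankIs-dual (TRIBES-dual n m) (TRIBESd-dual n m) (TRIBESd-rank n m 2≤m) , TRIBESd-rank n m 2≤m) ,
  (λ m 1≤m → ANDPARITY-rank n m 1≤n 1≤m)
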